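{- For all positive integers $s,t$, the complete tripartite graph $K_{1,s,t}$ has the property $M(3)$. Consequently, if $\max\{s,t\}\ge 2$, then $\mathrm{m}(K_{1,s,t})=3$.
   Context: $K_{1,s,t}$ denotes the complete tripartite graph with parts of sizes $1,s,t$. Given a graph $G$ and a list $L(v)$ of colors assigned to each vertex $v$, an $L$-coloring is a proper vertex coloring $c$ of $G$ with $c(v)\in L(v)$ for every vertex $v$. A graph $G$ is uniquely $k$-list colorable if there exist lists $L(v)$, each consisting of exactly $k$ colors, such that $G$ has exactly one $L$-coloring. $G$ has the property $M(k)$ if it is not uniquely $k$-list colorable, i.e. for every assignment of lists of size $k$ there is either no $L$-coloring or at least two. The m-number $\mathrm{m}(G)$ is the least integer $k$ such that $G$ has the property $M(k)$. -}

module Defs where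

open import Data.Nat using (ℕ; zero; suc; _+_; _≤_; _<_)
open import Data.Fin using (Fin; splitAt)
open import Data.Vec using (Vec; lookup)
open import Data.Vec.Membership.Propositional using (_∈_)
open import Data.Sum using (_⊎_; inj₁; inj₂)
open import Data.Product using (Σ; _×_; ∃)
open import Relation.Nullary using (¬_)
open import Relation.Binary.PropositionalEquality using (_≡_; _≢_)

Graph : ℕ → Set₁
Graph n = Fin n → Fin n → Set

-- The three parts of K_{1,s,t}: vertices are Fin (1 + s + t);
-- part 0 = the first vertex, part 1 = the next s vertices, part 2 = the last t.
part : (s t : ℕ) → Fin (1 + s + t) → Fin 3
part s t v with splitAt (1 + s) v
... | inj₂ _ = Fin.suc (Fin.suc Fin.zero)
... | inj₁ w with splitAt 1 w
...   | inj₁ _ = Fin.zero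
...   | inj₂ _ = Fin.suc Fin.zero

K1st : (s t : ℕ) → Graph (1 + s + t)
K1st s t u v = part s t u ≢ part s t v

-- A list of exactly k colors (colors are natural numbers): a vector of k distinct entries.
Distinct : {k : ℕ} → Vec ℕ k → Set
Distinct {k} xs = ∀ (i j : Fin k) → lookup xs i ≡ lookup xs j → i ≡ j

ListAssignment : ℕ → ℕ → Set
ListAssignment n k = Fin n → Vec ℕ k

IsKList : {n k : ℕ} → ListAssignment n k → Set
IsKList {n} L = ∀ (v : Fin n) → Distinct (L v)

IsLColoring : {n k : ℕ} → Graph n → ListAssignment n k → (Fin n → ℕ) → Set
IsLColoring {n} G L c =
  (∀ (v : Fin n) → c v ∈ L v) × (∀ (u v : Fin n) → G u v → c u ≢ c v)

UniquelyListColorable : {n : ℕ} → Graph n → ℕ → Set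
UniquelyListColorable {n} G k =
  Σ (ListAssignment n k) λ L → IsKList L ×
    Σ (Fin n → ℕ) λ c → IsLColoring G L c ×
      (∀ (c' : Fin n → ℕ) → IsLColoring G L c' → ∀ (v : Fin n) → c' v ≡ c v)

HasM : {n : ℕ} → Graph n → ℕ → Set
HasM G k = ¬ UniquelyListColorable G k

MNumberIs : {n : ℕ} → Graph n → ℕ → Set
MNumberIs G k = 1 ≤ k × HasM G k × (∀ (j : ℕ) → 1 ≤ j → j < k → ¬ HasM G j)

{-# OPTIONS --safe #-}
-- Let c be the unique L-coloring for 3-lists and x the apex. Every vertex v has a color
-- alt v ∈ L v other than c v and c x. Uniqueness means that recoloring a single vertex u
-- with alt u is blocked by a neighbor colored alt u; for non-apex u, v in different parts
-- these blockers lie in the parts of v and u, so alt u = alt v would make them an adjacent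
-- pair of equal color. Hence keeping c x and switching every other vertex to alt gives a
-- second L-coloring. For the m-number, giving every vertex its own color shows that no
-- loopless graph has M(1), and an explicit 2-list assignment shows that M(2) fails.

module Submission where

open import Defs
open import Data.Nat using (ℕ; zero; suc; _+_; _≤_; _<_; _⊔_; s≤s; z≤n)
open import Data.Nat.Properties using (n<1+n; _≟_)
open import Data.Fin as Fin using (Fin; zero; suc; splitAt; _↑ʳ_; toℕ)
open import Data.Fin.Properties using (splitAt-↑ʳ; toℕ-injective; pigeonhole; ¬∀⟶∃¬; <⇒≢)
open import Data.Vec using (Vec; _∷_; []; lookup)
open import Data.Vec.Functional using (updateAt)
open import Data.Vec.Functional.Properties using (updateAt-updates; updateAt-minimal)
open import Data.Vec.Membership.DecPropositional _≟_ using (_∈_; _∉_; _∈?_)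
open import Data.Vec.Membership.Propositional.Properties using (∈-lookup)
open import Data.Vec.Relation.Unary.Any as Any using (here; there)
open import Data.Vec.Relation.Unary.Any.Properties using (lookup-index; singleton⁻)
open import Data.Sum as Sum using (_⊎_; inj₁; inj₂; [_,_]′)
open import Data.Product using (∃; _×_; _,_; proj₁; proj₂)
open import Data.Empty using (⊥; ⊥-elim)
open import Function using (id; const; _∘_)
open import Relation.Nullary using (¬_; yes; no)
open import Relation.Binary.PropositionalEquality

∈-pair⁻ : ∀ {x a b : ℕ} → x ∈ a ∷ b ∷ [] → x ≡ a ⊎ x ≡ b
∈-pair⁻ = Sum.map₂ singleton⁻ ∘ Any.toSum

∈-pair⁻ˡ : ∀ {x a b : ℕ} → x ∈ a ∷ b ∷ [] → x ≢ b → x ≡ a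
∈-pair⁻ˡ x∈ x≢b = [ id , ⊥-elim ∘ x≢b ]′ (∈-pair⁻ x∈)

∈-pair⁻ʳ : ∀ {x a b : ℕ} → x ∈ a ∷ b ∷ [] → x ≢ a → x ≡ b
∈-pair⁻ʳ x∈ x≢a = [ ⊥-elim ∘ x≢a , id ]′ (∈-pair⁻ x∈)

distinct-singleton : ∀ {a : ℕ} → Distinct (a ∷ [])
distinct-singleton zero zero _ = refl

distinct-pair : ∀ {a b : ℕ} → a ≢ b → Distinct (a ∷ b ∷ [])
distinct-pair a≢b zero       zero       _ = refl
distinct-pair a≢b zero       (suc zero) e = ⊥-elim (a≢b e)
distinct-pair a≢b (suc zero) zero       e = ⊥-elim (a≢b (sym e))
distinct-pair a≢b (suc zero) (suc zero) _ = refl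

-- If every entry of xs occurred in ys, sending each position of xs to a position of ys
-- holding the same entry would be injective, against the pigeonhole principle.
distinct-∃-∉ : ∀ {k} (xs : Vec ℕ (suc k)) → Distinct xs → (ys : Vec ℕ k) →
               ∃ λ x → x ∈ xs × x ∉ ys
distinct-∃-∉ {k} xs xs-distinct ys =
  let i , xsᵢ∉ys = ¬∀⟶∃¬ (suc k) (λ i → lookup xs i ∈ ys) (λ i → lookup xs i ∈? ys) all∈
  in lookup xs i , ∈-lookup i xs , xsᵢ∉ys
  where
  all∈ : ¬ (∀ i → lookup xs i ∈ ys)
  all∈ ∈ys with pigeonhole (n<1+n k) (Any.index ∘ ∈ys)
  ... | i , j , i<j , same-slot = <⇒≢ i<j (xs-distinct i j (begin
    lookup xs i                       ≡⟨ lookup-index (∈ys i) ⟩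
    lookup ys (Any.index (∈ys i))     ≡⟨ cong (lookup ys) same-slot ⟩
    lookup ys (Any.index (∈ys j))     ≡⟨ lookup-index (∈ys j) ⟨
    lookup xs j                       ∎))
    where open ≡-Reasoning

IsUniqueLColoring : ∀ {n k} → Graph n → ListAssignment n k → (Fin n → ℕ) → Set
IsUniqueLColoring G L c =
  IsLColoring G L c × (∀ c′ → IsLColoring G L c′ → ∀ v → c′ v ≡ c v)

module _ {n k} {G : Graph n} {L : ListAssignment n k}
         (G-symmetric : ∀ u v → G u v → G v u) (G-irreflexive : ∀ v → ¬ G v v) where

  recolor-isLColoring : ∀ {c u a} → IsLColoring G L c → a ∈ L u →
                        (∀ w → G u w → c w ≢ a) →
                        IsLColoring G L (updateAt c u (const a))
  recolor-isLColoring {c} {u} {a} (c∈L , c-proper) a∈Lu a-free = c′∈L , c′-proper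
    where
    c′∈L : ∀ w → updateAt c u (const a) w ∈ L w
    c′∈L w with w Fin.≟ u
    ... | yes refl rewrite updateAt-updates u {const a} c = a∈Lu
    ... | no w≢u   rewrite updateAt-minimal w u {const a} c w≢u = c∈L w

    c′-proper : ∀ w z → G w z → updateAt c u (const a) w ≢ updateAt c u (const a) z
    c′-proper w z wz with w Fin.≟ u | z Fin.≟ u
    ... | yes refl | yes refl = ⊥-elim (G-irreflexive w wz)
    ... | yes refl | no z≢u
      rewrite updateAt-updates u {const a} c | updateAt-minimal z u {const a} c z≢u =
        a-free z wz ∘ sym
    ... | no w≢u   | yes refl
      rewrite updateAt-minimal w u {const a} c w≢u | updateAt-updates u {const a} c =
        a-free w (G-symmetric w u wz)
    ... | no w≢u   | no z≢u
      rewrite updateAt-minimal w u {const a} c w≢u | updateAt-minimal z u {const a} c z≢u =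
        c-proper w z wz

  unique⇒recoloring-blocked : ∀ {c u a} → IsUniqueLColoring G L c → a ∈ L u → a ≢ c u →
                              ¬ (∀ w → G u w → c w ≢ a)
  unique⇒recoloring-blocked {c} {u} {a} (c-coloring , c-unique) a∈Lu a≢cu a-free =
    a≢cu (trans (sym (updateAt-updates u {const a} c))
                (c-unique _ (recolor-isLColoring c-coloring a∈Lu a-free) u))

uniquelyListColorable-1 : ∀ {n} {G : Graph n} → (∀ v → ¬ G v v) → UniquelyListColorable G 1
uniquelyListColorable-1 {G = G} G-irreflexive =
  (λ v → toℕ v ∷ []) , (λ _ → distinct-singleton) ,
  toℕ , ((λ _ → here refl) ,
         (λ u v uv e → G-irreflexive u (subst (G u) (sym (toℕ-injective e)) uv))) ,
  λ c′ (c′∈L , _) v → singleton⁻ (c′∈L v)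

K1st-symmetric : ∀ s t u v → K1st s t u v → K1st s t v u
K1st-symmetric s t u v uv = uv ∘ sym

K1st-irreflexive : ∀ s t v → ¬ K1st s t v v
K1st-irreflexive s t v vv = vv refl

part-suc≢0 : ∀ s t (w : Fin (s + t)) → part s t (suc w) ≢ zero
part-suc≢0 s t w with splitAt s w
... | inj₁ _ = λ ()
... | inj₂ _ = λ ()

part≡0⇒≡0 : ∀ s t {v} → part s t v ≡ zero → v ≡ zero
part≡0⇒≡0 s t {zero}  _      = refl
part≡0⇒≡0 s t {suc w} pv≡0 = ⊥-elim (part-suc≢0 s t w pv≡0)

nonzero-Fin3-other : ∀ {p q r : Fin 3} → p ≢ zero → q ≢ zero → r ≢ zero →
                     p ≢ q → r ≢ p → r ≡ q
nonzero-Fin3-other {zero} p≢0 _ _ _ _ = ⊥-elim (p≢0 refl)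
nonzero-Fin3-other {q = zero} _ q≢0 _ _ _ = ⊥-elim (q≢0 refl)
nonzero-Fin3-other {r = zero} _ _ r≢0 _ _ = ⊥-elim (r≢0 refl)
nonzero-Fin3-other {suc zero}       {suc zero}       _ _ _ p≢q _ = ⊥-elim (p≢q refl)
nonzero-Fin3-other {suc (suc zero)} {suc (suc zero)} _ _ _ p≢q _ = ⊥-elim (p≢q refl)
nonzero-Fin3-other {suc zero}       {suc (suc zero)} {suc zero}       _ _ _ _ r≢p = ⊥-elim (r≢p refl)
nonzero-Fin3-other {suc zero}       {suc (suc zero)} {suc (suc zero)} _ _ _ _ _ = refl
nonzero-Fin3-other {suc (suc zero)} {suc zero}       {suc zero}       _ _ _ _ _ = refl
nonzero-Fin3-other {suc (suc zero)} {suc zero}       {suc (suc zero)} _ _ _ _ r≢p = ⊥-elim (r≢p refl)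

module NoUniqueThreeListColoring
  (s t : ℕ) {L : ListAssignment (1 + s + t) 3} {c : Fin (1 + s + t) → ℕ}
  (L-distinct : IsKList L) (c-unique : IsUniqueLColoring (K1st s t) L c) where

  private
    P = part s t
    c∈L = proj₁ (proj₁ c-unique)
    c-proper = proj₂ (proj₁ c-unique)

    blocked : ∀ {u a} → a ∈ L u → a ≢ c u → ¬ (∀ w → K1st s t u w → c w ≢ a)
    blocked = unique⇒recoloring-blocked {G = K1st s t}
                (K1st-symmetric s t) (K1st-irreflexive s t) c-unique

    alternative : ∀ v → ∃ λ a → a ∈ L v × a ∉ c v ∷ c zero ∷ []
    alternative v = distinct-∃-∉ (L v) (L-distinct v) (c v ∷ c zero ∷ [])

  alt : Fin (1 + s + t) → ℕ
  alt v = proj₁ (alternative v)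

  alt∈L : ∀ v → alt v ∈ L v
  alt∈L v = proj₁ (proj₂ (alternative v))

  alt≢c : ∀ v → alt v ≢ c v
  alt≢c v = proj₂ (proj₂ (alternative v)) ∘ here

  alt≢c-apex : ∀ v → alt v ≢ c zero
  alt≢c-apex v = proj₂ (proj₂ (alternative v)) ∘ there ∘ here

  alt-differs-across-parts : ∀ u v → P u ≢ zero → P v ≢ zero → P u ≢ P v → alt u ≢ alt v
  alt-differs-across-parts u v Pu≢0 Pv≢0 Pu≢Pv altu≡altv =
    blocked (alt∈L v) (alt≢c v) λ z vz cz≡altv →
    blocked (alt∈L u) (alt≢c u) λ w uw cw≡altu →
    let Pw≡Pv = nonzero-Fin3-other Pu≢0 Pv≢0 (non-apex w cw≡altu) Pu≢Pv (uw ∘ sym)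
        Pz≡Pu = nonzero-Fin3-other Pv≢0 Pu≢0 (non-apex z cz≡altv) (Pu≢Pv ∘ sym) (vz ∘ sym)
    in c-proper w z (λ Pw≡Pz → Pu≢Pv (trans (sym Pz≡Pu) (trans (sym Pw≡Pz) Pw≡Pv)))
                    (trans cw≡altu (trans altu≡altv (sym cz≡altv)))
    where
    non-apex : ∀ {x} w → c w ≡ alt x → P w ≢ zero
    non-apex {x} w cw≡altx Pw≡0 =
      alt≢c-apex x (trans (sym cw≡altx) (cong c (part≡0⇒≡0 s t Pw≡0)))

  recolor-non-apex : Fin (1 + s + t) → ℕ
  recolor-non-apex zero    = c zero
  recolor-non-apex (suc w) = alt (suc w)

  recolor-non-apex-isLColoring : IsLColoring (K1st s t) L recolor-non-apex
  recolor-non-apex-isLColoring = ∈L , proper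
    where
    ∈L : ∀ v → recolor-non-apex v ∈ L v
    ∈L zero    = c∈L zero
    ∈L (suc w) = alt∈L (suc w)

    proper : ∀ u v → K1st s t u v → recolor-non-apex u ≢ recolor-non-apex v
    proper zero    zero    uv = ⊥-elim (uv refl)
    proper zero    (suc w) _  = alt≢c-apex (suc w) ∘ sym
    proper (suc w) zero    _  = alt≢c-apex (suc w)
    proper (suc w) (suc z) uv =
      alt-differs-across-parts (suc w) (suc z) (part-suc≢0 s t w) (part-suc≢0 s t z) uv

  non-apex⇒⊥ : Fin (s + t) → ⊥
  non-apex⇒⊥ w =
    alt≢c (suc w) (proj₂ c-unique recolor-non-apex recolor-non-apex-isLColoring (suc w))

  apex-only⇒⊥ : ¬ Fin (s + t) → ⊥
  apex-only⇒⊥ no-other = blocked (alt∈L zero) (alt≢c zero) λ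
    { zero    uv → ⊥-elim (uv refl)
    ; (suc w) _  → ⊥-elim (no-other w)
    }

Fin-inhabited⊎empty : ∀ m → Fin m ⊎ ¬ Fin m
Fin-inhabited⊎empty zero    = inj₂ λ ()
Fin-inhabited⊎empty (suc m) = inj₁ zero

K1st-hasM3 : ∀ s t → HasM (K1st s t) 3
K1st-hasM3 s t (L , L-distinct , c , c-unique) =
  [ non-apex⇒⊥ , apex-only⇒⊥ ]′ (Fin-inhabited⊎empty (s + t))
  where open NoUniqueThreeListColoring s t L-distinct c-unique

data VertexClass : Set where
  apex firstA otherA firstB otherB : VertexClass

partOf : VertexClass → Fin 3
partOf apex   = zero
partOf firstA = suc zero
partOf otherA = suc zero
partOf firstB = suc (suc zero)
partOf otherB = suc (suc zero)

classOf : ∀ s t → Fin (1 + s + t) → VertexClass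
classOf s t v with splitAt (1 + s) v
... | inj₂ zero    = firstB
... | inj₂ (suc _) = otherB
... | inj₁ w with splitAt 1 w
...   | inj₁ _       = apex
...   | inj₂ zero    = firstA
...   | inj₂ (suc _) = otherA

part≡partOf-classOf : ∀ s t v → part s t v ≡ partOf (classOf s t v)
part≡partOf-classOf s t v with splitAt (1 + s) v
... | inj₂ zero    = refl
... | inj₂ (suc _) = refl
... | inj₁ w with splitAt 1 w
...   | inj₁ _       = refl
...   | inj₂ zero    = refl
...   | inj₂ (suc _) = refl

classOf-firstB : ∀ s t → classOf s (suc t) (suc s ↑ʳ zero) ≡ firstB
classOf-firstB s t rewrite splitAt-↑ʳ (suc s) (suc t) (zero {t}) = refl

classOf-otherB : ∀ s t (j : Fin t) → classOf s (suc t) (suc s ↑ʳ suc j) ≡ otherB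
classOf-otherB s t j rewrite splitAt-↑ʳ (suc s) (suc t) (suc j) = refl

colorOf : Fin 3 → ℕ
colorOf zero             = 1
colorOf (suc zero)       = 0
colorOf (suc (suc zero)) = 2

colorOf-injective : ∀ {p q} → colorOf p ≡ colorOf q → p ≡ q
colorOf-injective {zero}             {zero}             _ = refl
colorOf-injective {suc zero}         {suc zero}         _ = refl
colorOf-injective {suc (suc zero)}   {suc (suc zero)}   _ = refl
colorOf-injective {zero}             {suc zero}         ()
colorOf-injective {zero}             {suc (suc zero)}   ()
colorOf-injective {suc zero}         {zero}             ()
colorOf-injective {suc zero}         {suc (suc zero)}   ()
colorOf-injective {suc (suc zero)}   {zero}             ()
colorOf-injective {suc (suc zero)}   {suc zero}         ()

rivalPart : VertexClass → Fin 3
rivalPart apex   = suc zero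
rivalPart firstA = suc (suc zero)
rivalPart otherA = zero
rivalPart firstB = suc zero
rivalPart otherB = zero

rivalPart≢partOf : ∀ k → rivalPart k ≢ partOf k
rivalPart≢partOf apex   ()
rivalPart≢partOf firstA ()
rivalPart≢partOf otherA ()
rivalPart≢partOf firstB ()
rivalPart≢partOf otherB ()

-- Part p has color colorOf p, and each vertex may also take the color of its rival part.
-- The apex cannot take 0, since then the first vertices of A and B would both need 2;
-- a second vertex of A or of B then pins down the first vertices, which exclude every
-- rival color.
listOf : VertexClass → Vec ℕ 2
listOf k = colorOf (partOf k) ∷ colorOf (rivalPart k) ∷ []

module UniqueTwoListColoring (s′ t′ : ℕ) where

  private
    s = suc s′
    t = suc t′
    G = K1st s t

  L : ListAssignment (1 + s + t) 2
  L v = listOf (classOf s t v)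

  coloring : Fin (1 + s + t) → ℕ
  coloring v = colorOf (part s t v)

  L-isKList : IsKList L
  L-isKList v = distinct-pair (rivalPart≢partOf (classOf s t v) ∘ sym ∘ colorOf-injective)

  coloring-isLColoring : IsLColoring G L coloring
  coloring-isLColoring =
    (λ v → here (cong colorOf (part≡partOf-classOf s t v))) , (λ u v uv → uv ∘ colorOf-injective)

  representative : Fin 3 → Fin (1 + s + t)
  representative zero             = zero
  representative (suc zero)       = suc zero
  representative (suc (suc zero)) = suc s ↑ʳ zero

  part-representative : ∀ p → part s t (representative p) ≡ p
  part-representative zero             = refl
  part-representative (suc zero)       = refl
  part-representative (suc (suc zero)) =
    trans (part≡partOf-classOf s t (suc s ↑ʳ zero)) (cong partOf (classOf-firstB s t′))

  module _ {c′ : Fin (1 + s + t) → ℕ} (c′-coloring : IsLColoring G L c′) where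

    private
      c′∈L = proj₁ c′-coloring
      c′-proper = proj₂ c′-coloring

    agree-on-representatives⇒agree : (∀ p → c′ (representative p) ≡ colorOf p) →
                                     ∀ v → c′ v ≡ coloring v
    agree-on-representatives⇒agree c′-rep v =
      trans (∈-pair⁻ˡ (c′∈L v) c′v≢rival) (cong colorOf (sym (part≡partOf-classOf s t v)))
      where
      k = classOf s t v
      c′v≢rival : c′ v ≢ colorOf (rivalPart k)
      c′v≢rival c′v≡rival =
        c′-proper v (representative (rivalPart k))
          (λ Pv≡Pr → rivalPart≢partOf k (trans (sym (part-representative (rivalPart k)))
                                               (trans (sym Pv≡Pr) (part≡partOf-classOf s t v))))
          (trans c′v≡rival (sym (c′-rep (rivalPart k))))

    private
      ∈listOf : ∀ {v k} → classOf s t v ≡ k → c′ v ∈ listOf k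
      ∈listOf {v} v∈k = subst (λ k → c′ v ∈ listOf k) v∈k (c′∈L v)

      differ : ∀ {u v k l} → classOf s t u ≡ k → classOf s t v ≡ l → partOf k ≢ partOf l →
               c′ u ≢ c′ v
      differ {u} {v} u∈k v∈l k≢l = c′-proper u v λ Pu≡Pv →
        k≢l (trans (sym (part-class {u} u∈k)) (trans Pu≡Pv (part-class {v} v∈l)))
        where
        part-class : ∀ {w k} → classOf s t w ≡ k → part s t w ≡ partOf k
        part-class {w} w∈k = trans (part≡partOf-classOf s t w) (cong partOf w∈k)

      x a b : Fin (1 + s + t)
      x = representative zero
      a = representative (suc zero)
      b = representative (suc (suc zero))

      b-class : classOf s t b ≡ firstB
      b-class = classOf-firstB s t′

      x≡1 : c′ x ≡ 1
      x≡1 = ∈-pair⁻ˡ (∈listOf {x} refl) λ x≡0 →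
        differ {a} {b} refl b-class (λ ()) (trans (a≡2 x≡0) (sym (b≡2 x≡0)))
        where
        a≡2 : c′ x ≡ 0 → c′ a ≡ 2
        a≡2 x≡0 = ∈-pair⁻ʳ (∈listOf {a} refl) λ a≡0 →
          differ {x} {a} refl refl (λ ()) (trans x≡0 (sym a≡0))
        b≡2 : c′ x ≡ 0 → c′ b ≡ 2
        b≡2 x≡0 = ∈-pair⁻ˡ (∈listOf b-class) λ b≡0 →
          differ {x} {b} refl b-class (λ ()) (trans x≡0 (sym b≡0))

      a≡0×b≡2 : 1 ≤ s′ ⊎ 1 ≤ t′ → c′ a ≡ 0 × c′ b ≡ 2
      a≡0×b≡2 (inj₁ (s≤s z≤n)) = a≡0 , b≡2
        where
        a₂ = suc (suc zero)
        a₂≡0 = ∈-pair⁻ˡ (∈listOf {a₂} refl) λ a₂≡1 →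
          differ {x} {a₂} refl refl (λ ()) (trans x≡1 (sym a₂≡1))
        b≡2 = ∈-pair⁻ˡ (∈listOf b-class) λ b≡0 →
          differ {a₂} {b} refl b-class (λ ()) (trans a₂≡0 (sym b≡0))
        a≡0 = ∈-pair⁻ˡ (∈listOf {a} refl) λ a≡2 →
          differ {a} {b} refl b-class (λ ()) (trans a≡2 (sym b≡2))
      a≡0×b≡2 (inj₂ (s≤s z≤n)) = a≡0 , b≡2
        where
        b₂ = suc s ↑ʳ suc zero
        b₂-class = classOf-otherB s t′ zero
        b₂≡2 = ∈-pair⁻ˡ (∈listOf b₂-class) λ b₂≡1 →
          differ {x} {b₂} refl b₂-class (λ ()) (trans x≡1 (sym b₂≡1))
        a≡0 = ∈-pair⁻ˡ (∈listOf {a} refl) λ a≡2 →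
          differ {a} {b₂} refl b₂-class (λ ()) (trans a≡2 (sym b₂≡2))
        b≡2 = ∈-pair⁻ˡ (∈listOf b-class) λ b≡0 →
          differ {a} {b} refl b-class (λ ()) (trans a≡0 (sym b≡0))

    agree-on-representatives : 1 ≤ s′ ⊎ 1 ≤ t′ → ∀ p → c′ (representative p) ≡ colorOf p
    agree-on-representatives _   zero             = x≡1
    agree-on-representatives big (suc zero)       = proj₁ (a≡0×b≡2 big)
    agree-on-representatives big (suc (suc zero)) = proj₂ (a≡0×b≡2 big)

1≤⊔⇒1≤⊎1≤ : ∀ m n → 1 ≤ m ⊔ n → 1 ≤ m ⊎ 1 ≤ n
1≤⊔⇒1≤⊎1≤ (suc _) _ _   = inj₁ (s≤s z≤n)
1≤⊔⇒1≤⊎1≤ zero    _ 1≤n = inj₂ 1≤n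

K1st-uniquelyListColorable-2 : ∀ s t → 1 ≤ s → 1 ≤ t → 2 ≤ s ⊔ t →
                               UniquelyListColorable (K1st s t) 2
K1st-uniquelyListColorable-2 (suc s′) (suc t′) _ _ (s≤s 1≤s′⊔t′) =
  L , L-isKList , coloring , coloring-isLColoring , λ c′ c′-coloring →
    agree-on-representatives⇒agree c′-coloring
      (agree-on-representatives c′-coloring (1≤⊔⇒1≤⊎1≤ s′ t′ 1≤s′⊔t′))
  where open UniqueTwoListColoring s′ t′

K1st-mNumber≡3 : ∀ s t → 1 ≤ s → 1 ≤ t → 2 ≤ s ⊔ t → MNumberIs (K1st s t) 3
K1st-mNumber≡3 s t 1≤s 1≤t 2≤s⊔t = s≤s z≤n , K1st-hasM3 s t , no-smaller
  where
  no-smaller : ∀ j → 1 ≤ j → j < 3 → ¬ HasM (K1st s t) j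
  no-smaller 1 _ _ hasM1 = hasM1 (uniquelyListColorable-1 (K1st-irreflexive s t))
  no-smaller 2 _ _ hasM2 = hasM2 (K1st-uniquelyListColorable-2 s t 1≤s 1≤t 2≤s⊔t)
  no-smaller (suc (suc (suc _))) _ (s≤s (s≤s (s≤s ())))

proposition3p6 : ((s t : ℕ) → 1 ≤ s → 1 ≤ t → HasM (K1st s t) 3)
    × ((s t : ℕ) → 1 ≤ s → 1 ≤ t → 2 ≤ s ⊔ t → MNumberIs (K1st s t) 3)
proposition3p6 = (λ s t _ _ → K1st-hasM3 s t) , K1st-mNumber≡3
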